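{- Let $(u,\dot u,\Sigma\dashv\Delta)$ be a generalized category with families. Then the functor $\Sigma\colon\dot{\mathcal U}\to\mathcal U$ is faithful.
   Context: A generalized category with families consists of: a small category $\mathcal{B}$ with terminal object; Grothendieck fibrations $u\colon\mathcal{U}\to\mathcal{B}$ and $\dot u\colon\dot{\mathcal{U}}\to\mathcal{B}$; a fibration morphism $\Sigma\colon\dot{\mathcal U}\to\mathcal U$ (a functor with $u\Sigma=\dot u$ preserving cartesian arrows) which has a right adjoint functor $\Delta\colon\mathcal U\to\dot{\mathcal U}$ (not required to commute with the projections) such that every component of the unit is $\dot u$-cartesian and every component of the counit is $u$-cartesian. -}

module Defs where

open import Level using (Level; _⊔_; suc)
open import Relation.Binary using (IsEquivalence)
open import Relation.Binary.PropositionalEquality using (_≡_; subst₂)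
open import Data.Product using (Σ; Σ-syntax; _×_; _,_)

record Category (o ℓ e : Level) : Set (suc (o ⊔ ℓ ⊔ e)) where
  infixr 9 _∘_
  infix  4 _≈_
  field
    Obj       : Set o
    Hom       : Obj → Obj → Set ℓ
    _≈_       : ∀ {A B} → Hom A B → Hom A B → Set e
    id        : ∀ {A} → Hom A A
    _∘_       : ∀ {A B C} → Hom B C → Hom A B → Hom A C
    ≈-equiv   : ∀ {A B} → IsEquivalence (_≈_ {A} {B})
    ∘-resp-≈  : ∀ {A B C} {f f' : Hom B C} {g g' : Hom A B} →
                f ≈ f' → g ≈ g' → f ∘ g ≈ f' ∘ g'
    assoc     : ∀ {A B C D} {f : Hom C D} {g : Hom B C} {h : Hom A B} →
                (f ∘ g) ∘ h ≈ f ∘ (g ∘ h)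
    identityˡ : ∀ {A B} {f : Hom A B} → id ∘ f ≈ f
    identityʳ : ∀ {A B} {f : Hom A B} → f ∘ id ≈ f

  transport : ∀ {A A' B B'} → A ≡ A' → B ≡ B' → Hom A B → Hom A' B'
  transport p q f = subst₂ Hom p q f

open Category

record Functor {o ℓ e o' ℓ' e'} (C : Category o ℓ e) (D : Category o' ℓ' e')
       : Set (o ⊔ ℓ ⊔ e ⊔ o' ⊔ ℓ' ⊔ e') where
  field
    F₀           : Obj C → Obj D
    F₁           : ∀ {A B} → Hom C A B → Hom D (F₀ A) (F₀ B)
    identity     : ∀ {A} → _≈_ D (F₁ (id C {A})) (id D)
    homomorphism : ∀ {A B X} {f : Hom C A B} {g : Hom C B X} →
                   _≈_ D (F₁ (_∘_ C g f)) (_∘_ D (F₁ g) (F₁ f))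
    F-resp-≈     : ∀ {A B} {f g : Hom C A B} → _≈_ C f g → _≈_ D (F₁ f) (F₁ g)

open Functor

idF : ∀ {o ℓ e} (C : Category o ℓ e) → Functor C C
idF C = record
  { F₀ = λ A → A ; F₁ = λ f → f
  ; identity = IsEquivalence.refl (≈-equiv C)
  ; homomorphism = IsEquivalence.refl (≈-equiv C)
  ; F-resp-≈ = λ p → p }

_∘F_ : ∀ {o ℓ e o' ℓ' e' o'' ℓ'' e''}
         {C : Category o ℓ e} {D : Category o' ℓ' e'} {E : Category o'' ℓ'' e''} →
       Functor D E → Functor C D → Functor C E
_∘F_ {E = E} G F = record
  { F₀ = λ A → F₀ G (F₀ F A)
  ; F₁ = λ f → F₁ G (F₁ F f)
  ; identity = IsEquivalence.trans (≈-equiv E) (F-resp-≈ G (identity F)) (identity G)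
  ; homomorphism = IsEquivalence.trans (≈-equiv E) (F-resp-≈ G (homomorphism F)) (homomorphism G)
  ; F-resp-≈ = λ p → F-resp-≈ G (F-resp-≈ F p) }

record NatTrans {o ℓ e o' ℓ' e'} {C : Category o ℓ e} {D : Category o' ℓ' e'}
       (F G : Functor C D) : Set (o ⊔ ℓ ⊔ ℓ' ⊔ e') where
  field
    η           : ∀ X → Hom D (F₀ F X) (F₀ G X)
    commute     : ∀ {X Y} (f : Hom C X Y) →
                  _≈_ D (_∘_ D (η Y) (F₁ F f)) (_∘_ D (F₁ G f) (η X))

record Adjunction {o ℓ e o' ℓ' e'} {C : Category o ℓ e} {D : Category o' ℓ' e'}
       (L : Functor C D) (R : Functor D C) : Set (o ⊔ ℓ ⊔ e ⊔ o' ⊔ ℓ' ⊔ e') where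
  field
    unit   : NatTrans (idF C) (R ∘F L)
    counit : NatTrans (L ∘F R) (idF D)
    zig    : ∀ {A : Obj C} →
             _≈_ D (_∘_ D (NatTrans.η counit (F₀ L A)) (F₁ L (NatTrans.η unit A))) (id D)
    zag    : ∀ {B : Obj D} →
             _≈_ C (_∘_ C (F₁ R (NatTrans.η counit B)) (NatTrans.η unit (F₀ R B))) (id C)

record Terminal {o ℓ e} (C : Category o ℓ e) : Set (o ⊔ ℓ ⊔ e) where
  field
    ⊤        : Obj C
    !        : ∀ {A} → Hom C A ⊤
    !-unique : ∀ {A} (f : Hom C A ⊤) → _≈_ C ! f

module _ {o ℓ e o' ℓ' e'} {E : Category o ℓ e} {B : Category o' ℓ' e'}
         (p : Functor E B) where

  IsCartesian : ∀ {X Y} → Hom E X Y → Set (o ⊔ ℓ ⊔ e ⊔ ℓ' ⊔ e')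
  IsCartesian {X} {Y} f =
    ∀ {Z} (g : Hom E Z Y) (h : Hom B (F₀ p Z) (F₀ p X)) →
    _≈_ B (_∘_ B (F₁ p f) h) (F₁ p g) →
    Σ[ k ∈ Hom E Z X ]
      ((_≈_ B (F₁ p k) h × _≈_ E (_∘_ E f k) g) ×
       (∀ (k' : Hom E Z X) → _≈_ B (F₁ p k') h → _≈_ E (_∘_ E f k') g → _≈_ E k k'))

  record IsFibration : Set (o ⊔ ℓ ⊔ e ⊔ o' ⊔ ℓ' ⊔ e') where
    field
      lift : ∀ {I} (Y : Obj E) (a : Hom B I (F₀ p Y)) →
             Σ[ X ∈ Obj E ] Σ[ f ∈ Hom E X Y ] Σ[ q ∈ F₀ p X ≡ I ]
               (IsCartesian f × _≈_ B (transport B q _≡_.refl (F₁ p f)) a)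

record FunctorEq {o ℓ e o' ℓ' e'} {C : Category o ℓ e} {D : Category o' ℓ' e'}
       (F G : Functor C D) : Set (o ⊔ ℓ ⊔ o' ⊔ e') where
  field
    eq₀ : ∀ X → F₀ F X ≡ F₀ G X
    eq₁ : ∀ {X Y} (f : Hom C X Y) →
          _≈_ D (transport D (eq₀ X) (eq₀ Y) (F₁ F f)) (F₁ G f)

Faithful : ∀ {o ℓ e o' ℓ' e'} {C : Category o ℓ e} {D : Category o' ℓ' e'} →
           Functor C D → Set (o ⊔ ℓ ⊔ e ⊔ e')
Faithful {C = C} {D = D} F =
  ∀ {X Y} (f g : Hom C X Y) → _≈_ D (F₁ F f) (F₁ F g) → _≈_ C f g

record GCwF (o ℓ e o₁ ℓ₁ e₁ o₂ ℓ₂ e₂ : Level)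
       : Set (suc (o ⊔ ℓ ⊔ e ⊔ o₁ ⊔ ℓ₁ ⊔ e₁ ⊔ o₂ ⊔ ℓ₂ ⊔ e₂)) where
  field
    𝓑        : Category o ℓ e
    terminal : Terminal 𝓑
    𝓤        : Category o₁ ℓ₁ e₁
    𝓤̇        : Category o₂ ℓ₂ e₂
    u        : Functor 𝓤 𝓑
    u̇        : Functor 𝓤̇ 𝓑
    u-fib    : IsFibration u
    u̇-fib    : IsFibration u̇
    Σᶠ       : Functor 𝓤̇ 𝓤
    Σ-over   : FunctorEq (u ∘F Σᶠ) u̇
    Σ-cart   : ∀ {X Y} (f : Hom 𝓤̇ X Y) → IsCartesian u̇ f → IsCartesian u (F₁ Σᶠ f)
    Δ        : Functor 𝓤 𝓤̇
    adj      : Adjunction Σᶠ Δ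
    unit-cart   : ∀ X → IsCartesian u̇ (NatTrans.η (Adjunction.unit adj) X)
    counit-cart : ∀ A → IsCartesian u (NatTrans.η (Adjunction.counit adj) A)

{-# OPTIONS --safe #-}
-- Σ f ≈ Σ g gives, through naturality of the unit, η ∘ f ≈ η ∘ g, and since Σ lies
-- over the base also u̇ f ≈ u̇ g. The unit being u̇-cartesian, the factorisation of
-- η ∘ g through η over u̇ g is unique, and both f and g are such factorisations.
module Submission where

open import Defs
open import Relation.Binary using (IsEquivalence)
open import Relation.Binary.PropositionalEquality using (_≡_; refl)
open import Data.Product using (_,_)

open Category
open Functor

module _ {o ℓ e} (C : Category o ℓ e) where

  transport-resp-≈ : ∀ {A A' B B'} (p : A ≡ A') (q : B ≡ B') {f g : Hom C A B} →
    _≈_ C f g → _≈_ C (transport C p q f) (transport C p q g)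
  transport-resp-≈ refl refl f≈g = f≈g

module _ {o ℓ e o' ℓ' e'} {E : Category o ℓ e} {B : Category o' ℓ' e'}
         (p : Functor E B) where

  cartesian-cancelˡ : ∀ {X Y Z} {c : Hom E X Y} → IsCartesian p c →
    {f g : Hom E Z X} → _≈_ B (F₁ p f) (F₁ p g) →
    _≈_ E (_∘_ E c f) (_∘_ E c g) → _≈_ E f g
  cartesian-cancelˡ {c = c} c-cart {f} {g} pf≈pg cf≈cg =
    let (_ , _ , unique) = c-cart (_∘_ E c g) (F₁ p g) (≈B.sym (homomorphism p))
    in ≈E.trans (≈E.sym (unique f pf≈pg cf≈cg)) (unique g ≈B.refl ≈E.refl)
    where
    module ≈E {X Y} = IsEquivalence (≈-equiv E {X} {Y})
    module ≈B {X Y} = IsEquivalence (≈-equiv B {X} {Y})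

module _ {o ℓ e o' ℓ' e' o'' ℓ'' e''}
         {C : Category o ℓ e} {D : Category o' ℓ' e'} {E : Category o'' ℓ'' e''}
         {F : Functor C D} {H : Functor D E} {K : Functor C E}
         (H∘F≡K : FunctorEq (H ∘F F) K) where
  open FunctorEq H∘F≡K

  FunctorEq-factor-resp-≈ : ∀ {X Y} {f g : Hom C X Y} →
    _≈_ D (F₁ F f) (F₁ F g) → _≈_ E (F₁ K f) (F₁ K g)
  FunctorEq-factor-resp-≈ {X} {Y} {f} {g} Ff≈Fg =
    ≈E.trans (≈E.sym (eq₁ f))
      (≈E.trans (transport-resp-≈ E (eq₀ X) (eq₀ Y) (F-resp-≈ H Ff≈Fg)) (eq₁ g))
    where module ≈E {X Y} = IsEquivalence (≈-equiv E {X} {Y})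

module _ {o ℓ e o' ℓ' e'} {C : Category o ℓ e} {D : Category o' ℓ' e'}
         {L : Functor C D} {R : Functor D C} (L⊣R : Adjunction L R) where
  open NatTrans (Adjunction.unit L⊣R)

  unit-∘-resp-≈ : ∀ {X Y} {f g : Hom C X Y} → _≈_ D (F₁ L f) (F₁ L g) →
    _≈_ C (_∘_ C (η Y) f) (_∘_ C (η Y) g)
  unit-∘-resp-≈ {f = f} {g} Lf≈Lg =
    ≈C.trans (commute f) (≈C.trans (∘-resp-≈ C (F-resp-≈ R Lf≈Lg) ≈C.refl) (≈C.sym (commute g)))
    where module ≈C {X Y} = IsEquivalence (≈-equiv C {X} {Y})

  faithful-if-unit-cartesian : ∀ {o'' ℓ'' e''} {B : Category o'' ℓ'' e''} (p : Functor C B) →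
    (∀ X → IsCartesian p (η X)) →
    (∀ {X Y} {f g : Hom C X Y} → _≈_ D (F₁ L f) (F₁ L g) → _≈_ B (F₁ p f) (F₁ p g)) →
    Faithful L
  faithful-if-unit-cartesian p η-cart L≈⇒p≈ f g Lf≈Lg =
    cartesian-cancelˡ p (η-cart _) (L≈⇒p≈ Lf≈Lg) (unit-∘-resp-≈ Lf≈Lg)

proposition2p2 : ∀ {o ℓ e o₁ ℓ₁ e₁ o₂ ℓ₂ e₂} (G : GCwF o ℓ e o₁ ℓ₁ e₁ o₂ ℓ₂ e₂) →
    Faithful (GCwF.Σᶠ G)
proposition2p2 G =
  faithful-if-unit-cartesian adj u̇ unit-cart (FunctorEq-factor-resp-≈ {F = Σᶠ} {H = u} Σ-over)
  where open GCwF G
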